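{- Let $\mathcal{C}$ be a clutter on a finite set $E$ satisfying the tilde-full condition. Then the incidence vectors of the hyperedges of $\tilde{\mathcal{C}}$ are affinely independent if and only if the maximum fractional packing of $\mathcal{C}$ is unique.
   Context: A clutter on $E$ is a family of subsets none containing another (members: hyperedges). A transversal is an inclusion-minimal subset meeting all hyperedges; $\mathrm{bn}$ the minimum transversal size; $\mathrm{minb}$ the minimum-size transversals; minimum-transversal-covered means $\bigcup\mathrm{minb}(\mathcal{C})=E$. A fractional packing is $y:\mathcal{C}\to\mathbb{R}_{\ge0}$ with $\sum_{H\ni a}y(H)\le1$ for all $a$; a maximum fractional packing maximizes $\sum_Hy(H)$ (value $\mathrm{fpn}$); its support is $\{H:y(H)>0\}$. Integral blocking condition: $\mathrm{fpn}=\mathrm{bn}$. $\tilde{\mathcal{C}}=\{H\in\mathcal{C}:|H\cap B|=1\ \forall B\in\mathrm{minb}(\mathcal{C})\}$. Tilde-full condition: $\mathcal{C}$ is minimum-transversal-covered, satisfies the integral blocking condition, and every hyperedge of $\tilde{\mathcal{C}}$ lies in the support of some maximum fractional packing of $\mathcal{C}$.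
   Formalization: Fractional packings take nonnegative rational values instead of real ones, and affine independence of the incidence vectors of the hyperedges of $\tilde{\mathcal{C}}$ is taken over the rationals. -}

module Defs where

open import Data.Nat using (ℕ; zero; suc) renaming (_≤_ to _≤ℕ_)
open import Data.Fin using (Fin; zero; suc)
open import Data.Fin.Subset using (Subset; _∈_; _⊆_; _∩_; ∣_∣)
open import Data.Vec using (lookup)
open import Data.Bool using (if_then_else_)
open import Data.Integer using (+_)
open import Data.Rational using (ℚ; 0ℚ; 1ℚ; _+_; _≤_; _<_; _/_)
open import Data.Product using (Σ; ∃; _×_)
open import Relation.Binary.PropositionalEquality using (_≡_; _≢_)
open import Relation.Nullary using (¬_)

∑ : (m : ℕ) → (Fin m → ℚ) → ℚ
∑ zero    f = 0ℚ
∑ (suc m) f = f zero + ∑ m (λ i → f (suc i))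

IsClutter : {n m : ℕ} → (Fin m → Subset n) → Set
IsClutter {m = m} C = (i j : Fin m) → i ≢ j → ¬ (C i ⊆ C j)

module _ {n m : ℕ} (C : Fin m → Subset n) where

  Covers : Subset n → Set
  Covers B = (i : Fin m) → ∃ λ a → a ∈ B × a ∈ C i

  Transversal : Subset n → Set
  Transversal B = Covers B × ((B' : Subset n) → B' ⊆ B → Covers B' → B' ≡ B)

  MinTransversal : Subset n → Set
  MinTransversal B = Transversal B × ((B' : Subset n) → Transversal B' → ∣ B ∣ ≤ℕ ∣ B' ∣)

  MinTransversalCovered : Set
  MinTransversalCovered = (a : Fin n) → ∃ λ B → MinTransversal B × a ∈ B

  load : (Fin m → ℚ) → Fin n → ℚ
  load y a = ∑ m (λ i → if lookup (C i) a then y i else 0ℚ)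

  FractionalPacking : (Fin m → ℚ) → Set
  FractionalPacking y = ((i : Fin m) → 0ℚ ≤ y i) × ((a : Fin n) → load y a ≤ 1ℚ)

  value : (Fin m → ℚ) → ℚ
  value y = ∑ m y

  MaxFractionalPacking : (Fin m → ℚ) → Set
  MaxFractionalPacking y =
    FractionalPacking y × ((z : Fin m → ℚ) → FractionalPacking z → value z ≤ value y)

  IntegralBlocking : Set
  IntegralBlocking = ∃ λ y → ∃ λ B →
    MaxFractionalPacking y × MinTransversal B × value y ≡ (+ ∣ B ∣ / 1)

  InTilde : Fin m → Set
  InTilde i = (B : Subset n) → MinTransversal B → ∣ C i ∩ B ∣ ≡ 1

  TildeFull : Set
  TildeFull = MinTransversalCovered × IntegralBlocking ×
    ((i : Fin m) → InTilde i → ∃ λ y → MaxFractionalPacking y × 0ℚ < y i)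

  -- incidence vectors of the hyperedges of C̃ are affinely independent (over ℚ):
  -- every affine dependence Σ λ_H χ^H = 0, Σ λ_H = 0 supported on C̃ is trivial
  TildeAffinelyIndependent : Set
  TildeAffinelyIndependent = (λ' : Fin m → ℚ) →
    ((i : Fin m) → ¬ InTilde i → λ' i ≡ 0ℚ) →
    ∑ m λ' ≡ 0ℚ →
    ((a : Fin n) → load λ' a ≡ 0ℚ) →
    (i : Fin m) → λ' i ≡ 0ℚ

  UniqueMaxFractionalPacking : Set
  UniqueMaxFractionalPacking = (y z : Fin m → ℚ) →
    MaxFractionalPacking y → MaxFractionalPacking z → (i : Fin m) → y i ≡ z i

{-# OPTIONS --safe #-}
-- Complementary slackness: for a packing y and a transversal B,
-- value y ≤ ∑ᵢ yᵢ ∣Cᵢ ∩ B∣ = ∑_{a ∈ B} load y a ≤ ∣B∣. When fpn = bn both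
-- inequalities are termwise equalities for a maximum y and a minimum B, so every
-- maximum packing is supported on the tilde family and saturates every element of a
-- minimum transversal. Thus two maximum packings differ by an affine dependence among
-- the tilde hyperedges. Conversely, if the maximum packing y₀ is unique then it is
-- positive on every tilde hyperedge, so for an affine dependence c and small t > 0
-- the vector y₀ + t c is again a maximum packing, and uniqueness forces c = 0.
module Submission where

open import Defs
open import Data.Nat using (ℕ)
open import Data.Fin using (Fin)
open import Data.Fin.Subset using (Subset)
open import Data.Product using (_×_)

open import Data.Nat using (zero; suc)
import Data.Nat.Properties as ℕ
open import Data.Fin using (zero; suc)
open import Data.Fin.Subset using (_∈_; _∩_; ∣_∣)
open import Data.Fin.Subset.Properties using (x∈p∩q⁺)
open import Data.Vec using (_∷_; []; lookup)
open import Data.Vec.Properties using ([]=⇒lookup; lookup-zipWith)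
open import Data.Bool using (Bool; true; false; if_then_else_; _∧_)
import Data.Integer as ℤ
import Data.Integer.Properties as ℤ
open import Data.Rational
  using (ℚ; 0ℚ; 1ℚ; _+_; _*_; -_; _-_; _≤_; _<_; _/_; _⊓_; 1/_; toℚᵘ; NonZero; positive; nonNegative; nonPositive)
open import Data.Rational.Properties
import Data.Rational.Unnormalised as ℚᵘ
import Data.Rational.Unnormalised.Properties as ℚᵘ
open import Algebra.Properties.Group +-0-group using (x∙y⁻¹≈ε⇒x≈y; identityʳ-unique)
open import Data.Rational.Solver using (module +-*-Solver)
open import Data.Product using (∃; _,_; proj₁; proj₂)
open import Data.Sum using (inj₁; inj₂)
open import Data.Empty using (⊥-elim)
open import Relation.Binary.PropositionalEquality
open import Relation.Nullary using (¬_; yes; no)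
open import Relation.Nullary.Decidable using (decidable-stable)

∑-cong : ∀ k {f g : Fin k → ℚ} → (∀ i → f i ≡ g i) → ∑ k f ≡ ∑ k g
∑-cong zero    f≗g = refl
∑-cong (suc k) f≗g = cong₂ _+_ (f≗g zero) (∑-cong k (λ i → f≗g (suc i)))

∑-0 : ∀ k → ∑ k (λ _ → 0ℚ) ≡ 0ℚ
∑-0 zero    = refl
∑-0 (suc k) = trans (+-identityˡ _) (∑-0 k)

∑-+ : ∀ k (f g : Fin k → ℚ) → ∑ k (λ i → f i + g i) ≡ ∑ k f + ∑ k g
∑-+ zero    f g = refl
∑-+ (suc k) f g = trans (cong ((f zero + g zero) +_) (∑-+ k (λ i → f (suc i)) (λ i → g (suc i))))
                        (+-interchange (f zero) (g zero) _ _)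
  where open +-*-Solver
        +-interchange : ∀ a b c d → (a + b) + (c + d) ≡ (a + c) + (b + d)
        +-interchange = solve 4 (λ a b c d → (a :+ b) :+ (c :+ d) := (a :+ c) :+ (b :+ d)) refl

∑-* : ∀ k c (f : Fin k → ℚ) → ∑ k (λ i → c * f i) ≡ c * ∑ k f
∑-* zero    c f = sym (*-zeroʳ c)
∑-* (suc k) c f = trans (cong (c * f zero +_) (∑-* k c (λ i → f (suc i))))
                        (sym (*-distribˡ-+ c (f zero) _))

∑-neg : ∀ k (f : Fin k → ℚ) → ∑ k (λ i → - f i) ≡ - ∑ k f
∑-neg zero    f = refl
∑-neg (suc k) f = trans (cong (- f zero +_) (∑-neg k (λ i → f (suc i))))
                        (sym (neg-distrib-+ (f zero) _))

∑-- : ∀ k (f g : Fin k → ℚ) → ∑ k (λ i → f i - g i) ≡ ∑ k f - ∑ k g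
∑-- k f g = trans (∑-+ k f (λ i → - g i)) (cong (∑ k f +_) (∑-neg k g))

∑-swap : ∀ k l (F : Fin k → Fin l → ℚ) → ∑ k (λ a → ∑ l (F a)) ≡ ∑ l (λ i → ∑ k (λ a → F a i))
∑-swap zero    l F = sym (∑-0 l)
∑-swap (suc k) l F = trans (cong (∑ l (F zero) +_) (∑-swap k l (λ a → F (suc a))))
                           (sym (∑-+ l (F zero) _))

∑-mono : ∀ k {f g : Fin k → ℚ} → (∀ i → f i ≤ g i) → ∑ k f ≤ ∑ k g
∑-mono zero    f≤g = ≤-refl
∑-mono (suc k) f≤g = +-mono-≤ (f≤g zero) (∑-mono k (λ i → f≤g (suc i)))

∑-tight : ∀ k {f g : Fin k → ℚ} → (∀ i → f i ≤ g i) → ∑ k g ≤ ∑ k f → ∀ i → f i ≡ g i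
∑-tight (suc k) {f} {g} f≤g Σg≤Σf = λ where
    zero    → ≤-antisym (f≤g zero) (≮⇒≥ λ lt → absurd (+-mono-<-≤ lt (∑-mono k tail≤)))
    (suc i) → ∑-tight k tail≤ (≮⇒≥ λ lt → absurd (+-mono-≤-< (f≤g zero) lt)) i
  where
  tail≤ : ∀ i → f (suc i) ≤ g (suc i)
  tail≤ i = f≤g (suc i)
  absurd : ∀ {A : Set} → ∑ (suc k) f < ∑ (suc k) g → A
  absurd lt = ⊥-elim (<-irrefl refl (<-≤-trans lt Σg≤Σf))

0≤∑ : ∀ k {f : Fin k → ℚ} → (∀ i → 0ℚ ≤ f i) → 0ℚ ≤ ∑ k f
0≤∑ k {f} 0≤f = subst (_≤ ∑ k f) (∑-0 k) (∑-mono k 0≤f)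

term≤∑ : ∀ k {f : Fin k → ℚ} → (∀ i → 0ℚ ≤ f i) → ∀ j → f j ≤ ∑ k f
term≤∑ (suc k) {f} 0≤f zero    = subst (_≤ ∑ (suc k) f) (+-identityʳ (f zero))
                                       (+-monoʳ-≤ (f zero) (0≤∑ k (λ i → 0≤f (suc i))))
term≤∑ (suc k) {f} 0≤f (suc j) = subst (_≤ ∑ (suc k) f) (+-identityˡ (f (suc j)))
                                       (+-mono-≤ (0≤f zero) (term≤∑ k (λ i → 0≤f (suc i)) j))

*-cancelˡ-pos : ∀ {c p q} → 0ℚ < c → c * p ≡ c * q → p ≡ q
*-cancelˡ-pos {c} 0<c eq = ≤-antisym (*-cancelˡ-≤-pos c (≤-reflexive eq))
                                     (*-cancelˡ-≤-pos c (≤-reflexive (sym eq)))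
  where instance _ = positive 0<c

0<⊓ : ∀ {s t} → 0ℚ < s → 0ℚ < t → 0ℚ < s ⊓ t
0<⊓ {s} {t} 0<s 0<t with ⊓-sel s t
... | inj₁ s⊓t≡s = subst (0ℚ <_) (sym s⊓t≡s) 0<s
... | inj₂ s⊓t≡t = subst (0ℚ <_) (sym s⊓t≡t) 0<t

common-positive-step : ∀ K (P : ℚ → Fin K → Set) →
  (∀ k {s t} → 0ℚ ≤ s → s ≤ t → P t k → P s k) →
  (∀ k → ∃ λ t → 0ℚ < t × P t k) →
  ∃ λ t → 0ℚ < t × ∀ k → P t k
common-positive-step zero    P antitone step = 1ℚ , positive⁻¹ 1ℚ , λ ()
common-positive-step (suc K) P antitone step
  with step zero | common-positive-step K (λ t k → P t (suc k)) (λ k → antitone (suc k)) (λ k → step (suc k))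
... | t₀ , 0<t₀ , Pt₀ | t , 0<t , Pt = t₀ ⊓ t , 0<t₀⊓t , λ where
    zero    → antitone zero    (<⇒≤ 0<t₀⊓t) (p⊓q≤p t₀ t) Pt₀
    (suc k) → antitone (suc k) (<⇒≤ 0<t₀⊓t) (p⊓q≤q t₀ t) (Pt k)
  where
  0<t₀⊓t : 0ℚ < t₀ ⊓ t
  0<t₀⊓t = 0<⊓ 0<t₀ 0<t

nonneg-step-antitone : ∀ {x d s t} → 0ℚ ≤ x → 0ℚ ≤ s → s ≤ t → 0ℚ ≤ x + t * d → 0ℚ ≤ x + s * d
nonneg-step-antitone {x} {d} {s} {t} 0≤x 0≤s s≤t 0≤x+td with ≤-total 0ℚ d
... | inj₁ 0≤d = +-mono-≤ 0≤x (subst (_≤ s * d) (*-zeroʳ s) (*-monoˡ-≤-nonNeg s {{nonNegative 0≤s}} 0≤d))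
... | inj₂ d≤0 = ≤-trans 0≤x+td (+-monoʳ-≤ x (*-monoʳ-≤-nonPos d {{nonPositive d≤0}} s≤t))

nonneg-step-exists : ∀ {x d} → 0ℚ ≤ x → (d ≢ 0ℚ → 0ℚ < x) → ∃ λ t → 0ℚ < t × 0ℚ ≤ x + t * d
nonneg-step-exists {x} {d} 0≤x d≢0⇒0<x with 0ℚ ≤? d
... | yes 0≤d = 1ℚ , positive⁻¹ 1ℚ , +-mono-≤ 0≤x (subst (0ℚ ≤_) (sym (*-identityˡ d)) 0≤d)
... | no  0≰d = t , 0<t , ≤-reflexive (sym x+td≡0)
  where
  d<0 : d < 0ℚ
  d<0 = ≰⇒> 0≰d
  0<-d : 0ℚ < - d
  0<-d = neg-antimono-< d<0
  instance
    -d≢0 : NonZero (- d)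
    -d≢0 = pos⇒nonZero (- d) {{positive 0<-d}}
  t : ℚ
  t = x * 1/ (- d)
  0<t : 0ℚ < t
  0<t = positive⁻¹ t {{pos*pos⇒pos x {{positive (d≢0⇒0<x (<⇒≢ d<0))}}
                                    (1/ (- d)) {{1/pos⇒pos (- d) {{positive 0<-d}}}}}}
  open +-*-Solver
  x+td≡0 : x + t * d ≡ 0ℚ
  x+td≡0 = begin
    x + t * d                     ≡⟨ solve 3 (λ x i d → x :+ (x :* i) :* d := x :- x :* (i :* (:- d))) refl x (1/ (- d)) d ⟩
    x - x * (1/ (- d) * (- d))    ≡⟨ cong (λ u → x - x * u) (*-inverseˡ (- d)) ⟩
    x - x * 1ℚ                    ≡⟨ cong (λ u → x - u) (*-identityʳ x) ⟩
    x - x                         ≡⟨ +-inverseʳ x ⟩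
    0ℚ                            ∎
    where open ≡-Reasoning

when : Bool → ℚ → ℚ
when b x = if b then x else 0ℚ

when-+ : ∀ b x y → when b (x + y) ≡ when b x + when b y
when-+ true  x y = refl
when-+ false x y = refl

when-* : ∀ b c x → when b (c * x) ≡ c * when b x
when-* true  c x = refl
when-* false c x = sym (*-zeroʳ c)

when-- : ∀ b x y → when b (x - y) ≡ when b x - when b y
when-- true  x y = refl
when-- false x y = refl

when-∑ : ∀ b k (f : Fin k → ℚ) → when b (∑ k f) ≡ ∑ k (λ i → when b (f i))
when-∑ true  k f = refl
when-∑ false k f = sym (∑-0 k)

when-mono : ∀ b {x y} → x ≤ y → when b x ≤ when b y
when-mono true  x≤y = x≤y
when-mono false x≤y = ≤-refl

0≤when : ∀ b {x} → 0ℚ ≤ x → 0ℚ ≤ when b x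
0≤when true  0≤x = 0≤x
0≤when false 0≤x = ≤-refl

∑∈ : ∀ {n} → Subset n → (Fin n → ℚ) → ℚ
∑∈ {n} p f = ∑ n (λ a → when (lookup p a) (f a))

∣_∣ℚ : ∀ {n} → Subset n → ℚ
∣ p ∣ℚ = ∑∈ p (λ _ → 1ℚ)

ℕ/1-suc : ∀ k → ℤ.+ suc k / 1 ≡ 1ℚ + ℤ.+ k / 1
ℕ/1-suc k = toℚᵘ-injective (begin
    toℚᵘ (ℤ.+ suc k / 1)                   ≈⟨ toℚᵘ-fromℚᵘ (ℚᵘ.mkℚᵘ (ℤ.+ suc k) 0) ⟩
    ℚᵘ.mkℚᵘ (ℤ.+ suc k) 0                  ≈⟨ ℚᵘ.*≡* (cong (ℤ._* ℤ.1ℤ) (sym (cong (ℤ._+_ ℤ.1ℤ) (ℤ.*-identityʳ (ℤ.+ k))))) ⟩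
    ℚᵘ.1ℚᵘ ℚᵘ.+ ℚᵘ.mkℚᵘ (ℤ.+ k) 0           ≈⟨ ℚᵘ.+-congʳ ℚᵘ.1ℚᵘ (ℚᵘ.≃-sym (toℚᵘ-fromℚᵘ (ℚᵘ.mkℚᵘ (ℤ.+ k) 0))) ⟩
    toℚᵘ 1ℚ ℚᵘ.+ toℚᵘ (ℤ.+ k / 1)          ≈⟨ ℚᵘ.≃-sym (toℚᵘ-homo-+ 1ℚ (ℤ.+ k / 1)) ⟩
    toℚᵘ (1ℚ + ℤ.+ k / 1)                  ∎)
  where open ℚᵘ.≃-Reasoning

ℕ/1-injective : ∀ {j k} → ℤ.+ j / 1 ≡ ℤ.+ k / 1 → j ≡ k
ℕ/1-injective {j} {k} eq with fromℚᵘ-injective {ℚᵘ.mkℚᵘ (ℤ.+ j) 0} {ℚᵘ.mkℚᵘ (ℤ.+ k) 0} eq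
... | ℚᵘ.*≡* j*1≡k*1 = ℤ.+-injective (ℤ.*-cancelʳ-≡ (ℤ.+ j) (ℤ.+ k) ℤ.1ℤ j*1≡k*1)

∣p∣ℚ≡∣p∣/1 : ∀ {n} (p : Subset n) → ∣ p ∣ℚ ≡ ℤ.+ ∣ p ∣ / 1
∣p∣ℚ≡∣p∣/1 []          = refl
∣p∣ℚ≡∣p∣/1 (true ∷ p)  = trans (cong (1ℚ +_) (∣p∣ℚ≡∣p∣/1 p)) (sym (ℕ/1-suc ∣ p ∣))
∣p∣ℚ≡∣p∣/1 (false ∷ p) = trans (+-identityˡ _) (∣p∣ℚ≡∣p∣/1 p)

x∈p⇒1≤∣p∣ℚ : ∀ {n} {x : Fin n} {p : Subset n} → x ∈ p → 1ℚ ≤ ∣ p ∣ℚ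
x∈p⇒1≤∣p∣ℚ {n} {x} {p} x∈p = subst (_≤ ∣ p ∣ℚ) (cong (λ b → when b 1ℚ) ([]=⇒lookup x∈p))
  (term≤∑ n (λ a → 0≤when (lookup p a) (nonNegative⁻¹ 1ℚ)) x)

module Packings {n m : ℕ} (C : Fin m → Subset n) where

  load-+ : ∀ y z a → load C (λ i → y i + z i) a ≡ load C y a + load C z a
  load-+ y z a = trans (∑-cong m (λ i → when-+ (lookup (C i) a) (y i) (z i))) (∑-+ m _ _)

  load-* : ∀ c y a → load C (λ i → c * y i) a ≡ c * load C y a
  load-* c y a = trans (∑-cong m (λ i → when-* (lookup (C i) a) c (y i))) (∑-* m c _)

  load-- : ∀ y z a → load C (λ i → y i - z i) a ≡ load C y a - load C z a
  load-- y z a = trans (∑-cong m (λ i → when-- (lookup (C i) a) (y i) (z i))) (∑-- m _ _)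

  double-counting : ∀ y B → ∑∈ B (load C y) ≡ ∑ m (λ i → y i * ∣ C i ∩ B ∣ℚ)
  double-counting y B = begin
    ∑ n (λ a → when (lookup B a) (load C y a))
      ≡⟨ ∑-cong n (λ a → when-∑ (lookup B a) m _) ⟩
    ∑ n (λ a → ∑ m (λ i → when (lookup B a) (when (lookup (C i) a) (y i))))
      ≡⟨ ∑-swap n m _ ⟩
    ∑ m (λ i → ∑ n (λ a → when (lookup B a) (when (lookup (C i) a) (y i))))
      ≡⟨ ∑-cong m (λ i → trans (∑-cong n (λ a → nested a i)) (∑-* n (y i) _)) ⟩
    ∑ m (λ i → y i * ∣ C i ∩ B ∣ℚ)
      ∎
    where
    open ≡-Reasoning
    when-when : ∀ b c x → when b (when c x) ≡ x * when (c ∧ b) 1ℚ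
    when-when true  true  x = sym (*-identityʳ x)
    when-when true  false x = sym (*-zeroʳ x)
    when-when false true  x = sym (*-zeroʳ x)
    when-when false false x = sym (*-zeroʳ x)
    nested : ∀ a i → when (lookup B a) (when (lookup (C i) a) (y i)) ≡ y i * when (lookup (C i ∩ B) a) 1ℚ
    nested a i rewrite lookup-zipWith _∧_ a (C i) B = when-when (lookup B a) (lookup (C i) a) (y i)

  module Slackness {y : Fin m → ℚ} {B : Subset n} (y-packing : FractionalPacking C y)
                   (B-covers : Covers C B) (∣B∣≤value : ∣ B ∣ℚ ≤ value C y) where

    y≤y*∣Ci∩B∣ : ∀ i → y i ≤ y i * ∣ C i ∩ B ∣ℚ
    y≤y*∣Ci∩B∣ i with B-covers i
    ... | a , a∈B , a∈Ci = subst (_≤ y i * ∣ C i ∩ B ∣ℚ) (*-identityʳ (y i))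
      (*-monoˡ-≤-nonNeg (y i) {{nonNegative (proj₁ y-packing i)}} (x∈p⇒1≤∣p∣ℚ (x∈p∩q⁺ (a∈Ci , a∈B))))

    load-on-B≤1 : ∀ a → when (lookup B a) (load C y a) ≤ when (lookup B a) 1ℚ
    load-on-B≤1 a = when-mono (lookup B a) (proj₂ y-packing a)

    value≤load-on-B : value C y ≤ ∑∈ B (load C y)
    value≤load-on-B = subst (value C y ≤_) (sym (double-counting y B)) (∑-mono m y≤y*∣Ci∩B∣)

    weighted≤value : ∑ m (λ i → y i * ∣ C i ∩ B ∣ℚ) ≤ value C y
    weighted≤value = begin
      ∑ m (λ i → y i * ∣ C i ∩ B ∣ℚ)  ≡⟨ double-counting y B ⟨
      ∑∈ B (load C y)                 ≤⟨ ∑-mono n load-on-B≤1 ⟩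
      ∣ B ∣ℚ                          ≤⟨ ∣B∣≤value ⟩
      value C y                       ∎
      where open ≤-Reasoning

    positive⇒meets-once : ∀ i → 0ℚ < y i → ∣ C i ∩ B ∣ ≡ 1
    positive⇒meets-once i 0<yi = ℕ/1-injective (begin
      ℤ.+ ∣ C i ∩ B ∣ / 1   ≡⟨ ∣p∣ℚ≡∣p∣/1 (C i ∩ B) ⟨
      ∣ C i ∩ B ∣ℚ           ≡⟨ *-cancelˡ-pos 0<yi y*1≡y*∣Ci∩B∣ ⟨
      1ℚ                     ∎)
      where
      open ≡-Reasoning
      y*1≡y*∣Ci∩B∣ : y i * 1ℚ ≡ y i * ∣ C i ∩ B ∣ℚ
      y*1≡y*∣Ci∩B∣ = trans (*-identityʳ (y i)) (∑-tight m y≤y*∣Ci∩B∣ weighted≤value i)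

    ∈⇒saturated : ∀ {a} → a ∈ B → load C y a ≡ 1ℚ
    ∈⇒saturated {a} a∈B = subst (λ b → when b (load C y a) ≡ when b 1ℚ) ([]=⇒lookup a∈B)
      (∑-tight n load-on-B≤1 (≤-trans ∣B∣≤value value≤load-on-B) a)

  perturbation-max : ∀ {y d} → MaxFractionalPacking C y →
    (∀ a → load C d a ≡ 0ℚ) → value C d ≡ 0ℚ → (∀ i → 0ℚ ≤ y i + d i) →
    MaxFractionalPacking C (λ i → y i + d i)
  perturbation-max {y} {d} ((_ , y-load≤1) , y-max) d-load≡0 d-value≡0 0≤y+d =
    (0≤y+d , load≤1) , max
    where
    +0 : ∀ {u v} → v ≡ 0ℚ → u + v ≡ u
    +0 {u} v≡0 = trans (cong (u +_) v≡0) (+-identityʳ u)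
    load≤1 : ∀ a → load C (λ i → y i + d i) a ≤ 1ℚ
    load≤1 a = subst (_≤ 1ℚ) (sym (trans (load-+ y d a) (+0 (d-load≡0 a)))) (y-load≤1 a)
    max : ∀ z → FractionalPacking C z → value C z ≤ value C (λ i → y i + d i)
    max z z-packing = subst (value C z ≤_) (sym (trans (∑-+ m y d) (+0 d-value≡0))) (y-max z z-packing)

module TightDuality {n m : ℕ} (C : Fin m → Subset n) {y₀ : Fin m → ℚ} {B₀ : Subset n}
  (y₀-max : MaxFractionalPacking C y₀) (B₀-min : MinTransversal C B₀)
  (fpn≡bn : value C y₀ ≡ ℤ.+ ∣ B₀ ∣ / 1) where

  open Packings C

  max-value : ∀ {y} → MaxFractionalPacking C y → value C y ≡ value C y₀
  max-value (y-packing , y-max) = ≤-antisym (proj₂ y₀-max _ y-packing) (y-max _ (proj₁ y₀-max))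

  min-size : ∀ {B} → MinTransversal C B → ∣ B ∣ ≡ ∣ B₀ ∣
  min-size (B-transversal , B-min) = ℕ.≤-antisym (B-min _ (proj₁ B₀-min)) (proj₂ B₀-min _ B-transversal)

  max-value≡min-size : ∀ {y B} → MaxFractionalPacking C y → MinTransversal C B → value C y ≡ ∣ B ∣ℚ
  max-value≡min-size {y} {B} y-max B-min = begin
    value C y            ≡⟨ max-value y-max ⟩
    value C y₀           ≡⟨ fpn≡bn ⟩
    ℤ.+ ∣ B₀ ∣ / 1       ≡⟨ cong (λ k → ℤ.+ k / 1) (min-size B-min) ⟨
    ℤ.+ ∣ B ∣ / 1        ≡⟨ ∣p∣ℚ≡∣p∣/1 B ⟨
    ∣ B ∣ℚ               ∎
    where open ≡-Reasoning

  module MaxMinSlackness {y} (y-max : MaxFractionalPacking C y) {B} (B-min : MinTransversal C B) =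
    Slackness (proj₁ y-max) (proj₁ (proj₁ B-min)) (≤-reflexive (sym (max-value≡min-size y-max B-min)))

  max-support⊆tilde : ∀ {y} → MaxFractionalPacking C y → ∀ i → 0ℚ < y i → InTilde C i
  max-support⊆tilde y-max i 0<yi B B-min = MaxMinSlackness.positive⇒meets-once y-max B-min i 0<yi

  max-vanishes-off-tilde : ∀ {y} → MaxFractionalPacking C y → ∀ i → ¬ InTilde C i → y i ≡ 0ℚ
  max-vanishes-off-tilde y-max i i∉tilde =
    ≤-antisym (≮⇒≥ (λ 0<yi → i∉tilde (max-support⊆tilde y-max i 0<yi))) (proj₁ (proj₁ y-max) i)

  max-saturated : MinTransversalCovered C → ∀ {y} → MaxFractionalPacking C y → ∀ a → load C y a ≡ 1ℚ
  max-saturated covered y-max a with covered a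
  ... | B , B-min , a∈B = MaxMinSlackness.∈⇒saturated y-max B-min a∈B

  affinelyIndependent⇒unique : MinTransversalCovered C →
    TildeAffinelyIndependent C → UniqueMaxFractionalPacking C
  affinelyIndependent⇒unique covered independent y z y-max z-max i =
    x∙y⁻¹≈ε⇒x≈y (y i) (z i) (independent (λ i → y i - z i) off-tilde sum≡0 load≡0 i)
    where
    off-tilde : ∀ i → ¬ InTilde C i → y i - z i ≡ 0ℚ
    off-tilde i i∉tilde = cong₂ _-_ (max-vanishes-off-tilde y-max i i∉tilde)
                                    (max-vanishes-off-tilde z-max i i∉tilde)
    sum≡0 : ∑ m (λ i → y i - z i) ≡ 0ℚ
    sum≡0 = trans (∑-- m y z) (trans (cong₂ _-_ (max-value y-max) (max-value z-max)) (+-inverseʳ (value C y₀)))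
    load≡0 : ∀ a → load C (λ i → y i - z i) a ≡ 0ℚ
    load≡0 a = trans (load-- y z a)
                     (cong₂ _-_ (max-saturated covered y-max a) (max-saturated covered z-max a))

  unique⇒affinelyIndependent : (∀ i → InTilde C i → ∃ λ y → MaxFractionalPacking C y × 0ℚ < y i) →
    UniqueMaxFractionalPacking C → TildeAffinelyIndependent C
  unique⇒affinelyIndependent tilde-supported unique c c-off-tilde c-sum≡0 c-load≡0 j =
    *-cancelˡ-pos 0<t (trans t*cj≡0 (sym (*-zeroʳ t)))
    where
    0≤y₀ : ∀ k → 0ℚ ≤ y₀ k
    0≤y₀ = proj₁ (proj₁ y₀-max)
    -- Membership in the tilde family is not decidable, but positivity of y₀ k is.
    y₀-positive : ∀ k → c k ≢ 0ℚ → 0ℚ < y₀ k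
    y₀-positive k ck≢0 = decidable-stable (0ℚ <? y₀ k) λ 0≮y₀k → ck≢0 (c-off-tilde k λ k∈tilde →
      let y , y-max , 0<yk = tilde-supported k k∈tilde
      in 0≮y₀k (subst (0ℚ <_) (unique y y₀ y-max y₀-max k) 0<yk))
    step : ∃ λ t → 0ℚ < t × ∀ k → 0ℚ ≤ y₀ k + t * c k
    step = common-positive-step m (λ t k → 0ℚ ≤ y₀ k + t * c k)
             (λ k → nonneg-step-antitone (0≤y₀ k)) (λ k → nonneg-step-exists (0≤y₀ k) (y₀-positive k))
    t : ℚ
    t = proj₁ step
    0<t : 0ℚ < t
    0<t = proj₁ (proj₂ step)
    perturbed-max : MaxFractionalPacking C (λ i → y₀ i + t * c i)
    perturbed-max = perturbation-max y₀-max
      (λ a → trans (load-* t c a) (trans (cong (t *_) (c-load≡0 a)) (*-zeroʳ t)))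
      (trans (∑-* m t c) (trans (cong (t *_) c-sum≡0) (*-zeroʳ t)))
      (proj₂ (proj₂ step))
    t*cj≡0 : t * c j ≡ 0ℚ
    t*cj≡0 = identityʳ-unique (y₀ j) (t * c j) (sym (unique y₀ _ y₀-max perturbed-max j))

lemma5p1 : (n m : ℕ) (C : Fin m → Subset n) → IsClutter C → TildeFull C →
    (TildeAffinelyIndependent C → UniqueMaxFractionalPacking C) ×
    (UniqueMaxFractionalPacking C → TildeAffinelyIndependent C)
lemma5p1 n m C _ (covered , (y₀ , B₀ , y₀-max , B₀-min , fpn≡bn) , tilde-supported) =
  affinelyIndependent⇒unique covered , unique⇒affinelyIndependent tilde-supported
  where open TightDuality C y₀-max B₀-min fpn≡bn
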